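{- Let $A$ be a Glivenko residuated lattice. Then ${\rm Rad}({\rm Reg}(A))={\rm Rad}(A)\cap{\rm Reg}(A)$.
   Context: A (commutative) residuated lattice is an algebra $(A,\vee,\wedge,\odot,\rightarrow,0,1)$ such that $(A,\vee,\wedge,0,1)$ is a bounded lattice, $(A,\odot,1)$ is a commutative monoid, and for all $a,b,c\in A$: $a\le b\rightarrow c$ iff $a\odot b\le c$. Write $\neg a=a\rightarrow 0$. $A$ is Glivenko iff $\neg\neg(\neg\neg a\rightarrow a)=1$ for all $a\in A$. ${\rm Reg}(A)=\{a\in A\mid\neg\neg a=a\}$ with operations $a\odot^*b=\neg\neg(a\odot b)$, $a\vee^*b=\neg\neg(a\vee b)$, $a\wedge^*b=\neg\neg(a\wedge b)$, the restriction of $\rightarrow$, and $0,1$; for Glivenko $A$ this is a residuated lattice. A filter is a nonempty subset closed under $\odot$ and upward closed; a maximal filter is a maximal element among the filters different from the whole algebra; ${\rm Rad}$ of a residuated lattice is the intersection of all its maximal filters. -}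

module Defs where

open import Level using (Level; suc; _⊔_)
open import Data.Product using (Σ; ∃; _×_; _,_)
open import Relation.Nullary using () renaming (¬_ to Not_)
open import Data.Unit.Polymorphic using (⊤)
open import Relation.Binary.PropositionalEquality using (_≡_)

record ResLat (c : Level) : Set (suc c) where
  infixr 6 _∨_
  infixr 7 _∧_
  infixr 7 _⊙_
  infixr 5 _⇒_
  field
    Carrier : Set c
    _∨_ _∧_ _⊙_ _⇒_ : Carrier → Carrier → Carrier
    𝟘 𝟙 : Carrier
    ∨-assoc : ∀ a b d → (a ∨ b) ∨ d ≡ a ∨ (b ∨ d)
    ∧-assoc : ∀ a b d → (a ∧ b) ∧ d ≡ a ∧ (b ∧ d)
    ∨-comm : ∀ a b → a ∨ b ≡ b ∨ a
    ∧-comm : ∀ a b → a ∧ b ≡ b ∧ a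
    ∨-absorbs-∧ : ∀ a b → a ∨ (a ∧ b) ≡ a
    ∧-absorbs-∨ : ∀ a b → a ∧ (a ∨ b) ≡ a
  _≤_ : Carrier → Carrier → Set c
  a ≤ b = a ∧ b ≡ a
  field
    𝟘-least : ∀ a → 𝟘 ≤ a
    𝟙-greatest : ∀ a → a ≤ 𝟙
    ⊙-assoc : ∀ a b d → (a ⊙ b) ⊙ d ≡ a ⊙ (b ⊙ d)
    ⊙-comm : ∀ a b → a ⊙ b ≡ b ⊙ a
    ⊙-identityʳ : ∀ a → a ⊙ 𝟙 ≡ a
    residuation₁ : ∀ a b d → a ≤ (b ⇒ d) → (a ⊙ b) ≤ d
    residuation₂ : ∀ a b d → (a ⊙ b) ≤ d → a ≤ (b ⇒ d)

  ¬_ : Carrier → Carrier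
  ¬ a = a ⇒ 𝟘

  IsGlivenko : Set c
  IsGlivenko = ∀ a → ¬ (¬ ((¬ (¬ a)) ⇒ a)) ≡ 𝟙

  Reg : Carrier → Set c
  Reg a = ¬ (¬ a) ≡ a

  _⊙*_ _∧*_ : Carrier → Carrier → Carrier
  a ⊙* b = ¬ (¬ (a ⊙ b))
  a ∧* b = ¬ (¬ (a ∧ b))

-- Filters / maximal filters / radical of an algebra whose carrier is the
-- subset S of a type X, with monoid operation _·_ and lattice meet _⊓_
-- (order a ≤ b :⇔ a ⊓ b ≡ a).
-- Subsets of the carrier are predicates on X contained in S.
module FilterTheory {c : Level} {X : Set c} (S : X → Set c)
                    (_·_ _⊓_ : X → X → X) where

  Subset : Set (suc c)
  Subset = X → Set c

  _⊆_ : Subset → Subset → Set c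
  F ⊆ G = ∀ a → F a → G a

  IsFilter : Subset → Set c
  IsFilter F = (F ⊆ S)
             × (∃ λ a → F a)
             × (∀ a b → F a → F b → F (a · b))
             × (∀ a b → F a → S b → a ⊓ b ≡ a → F b)

  IsProper : Subset → Set c
  IsProper F = ∃ λ a → S a × Not F a

  IsMaximalFilter : Subset → Set (suc c)
  IsMaximalFilter M = IsFilter M × IsProper M
                    × (∀ G → IsFilter G → IsProper G → M ⊆ G → G ⊆ M)

  Rad : X → Set (suc c)
  Rad a = S a × (∀ M → IsMaximalFilter M → M a)

module _ {c : Level} (A : ResLat c) where
  open ResLat A

  private
    All : Carrier → Set c
    All _ = ⊤

  RadA : Carrier → Set (suc c)
  RadA = FilterTheory.Rad All _⊙_ _∧_

  RadReg : Carrier → Set (suc c)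
  RadReg = FilterTheory.Rad Reg _⊙*_ _∧*_

module Submission where

-- The double negation ¬¬ : A → Reg(A) links the filters of A and of Reg(A):
--   * a filter N of Reg(A) pulls back to the filter  N↑ = {x | ¬¬x ∈ N}  of A
--     (this needs  ¬¬x ⊙ ¬¬y ≤ ¬¬(x ⊙ y)  to see that N↑ is closed under ⊙);
--   * a filter G of A restricts to the filter  G↓ = G ∩ Reg(A)  of Reg(A).
-- Both constructions preserve properness, and they carry maximal filters to
-- maximal filters: a filter above N↑ (resp. G↓) is turned by the other
-- construction into a filter above N (resp. G), and maximality of N (resp. G)
-- then bounds it.  Since N↑ ∩ Reg(A) = N for N ⊆ Reg(A), an element of
-- Rad(Reg(A)) lies in every maximal M of A (via the maximal filter M↓), and a
-- regular element of Rad(A) lies in every maximal N of Reg(A) (via N↑).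

open import Defs
open import Level using (Level)
open import Function.Bundles using (_⇔_; mk⇔)
open import Data.Product using (_×_; _,_; proj₁; proj₂)
open import Data.Unit.Polymorphic using (⊤; tt)
open import Relation.Binary.PropositionalEquality
  using (_≡_; refl; sym; trans; cong; subst; module ≡-Reasoning)

module Calculus {c : Level} (A : ResLat c) where
  open ResLat A
  open ≡-Reasoning

  ≤-refl : ∀ a → a ≤ a
  ≤-refl a = trans (cong (a ∧_) (sym (∨-absorbs-∧ a a))) (∧-absorbs-∨ a (a ∧ a))

  ≤-trans : ∀ {a b d} → a ≤ b → b ≤ d → a ≤ d
  ≤-trans {a} {b} {d} a≤b b≤d = begin
    a ∧ d        ≡⟨ cong (_∧ d) (sym a≤b) ⟩
    (a ∧ b) ∧ d  ≡⟨ ∧-assoc a b d ⟩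
    a ∧ (b ∧ d)  ≡⟨ cong (a ∧_) b≤d ⟩
    a ∧ b        ≡⟨ a≤b ⟩
    a            ∎

  ≤-antisym : ∀ {a b} → a ≤ b → b ≤ a → a ≡ b
  ≤-antisym {a} {b} a≤b b≤a = trans (sym a≤b) (trans (∧-comm a b) b≤a)

  ≡-≤-trans : ∀ {a b d} → a ≡ b → b ≤ d → a ≤ d
  ≡-≤-trans refl b≤d = b≤d

  ≤-≡-trans : ∀ {a b d} → a ≤ b → b ≡ d → a ≤ d
  ≤-≡-trans a≤b refl = a≤b

  ∧-lowerʳ : ∀ a b → (a ∧ b) ≤ b
  ∧-lowerʳ a b = trans (∧-assoc a b b) (cong (a ∧_) (≤-refl b))

  ⇒-eval : ∀ y z → ((y ⇒ z) ⊙ y) ≤ z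
  ⇒-eval y z = residuation₁ _ _ _ (≤-refl _)

  ⊙-monoˡ : ∀ {a b} d → a ≤ b → (a ⊙ d) ≤ (b ⊙ d)
  ⊙-monoˡ d a≤b = residuation₁ _ _ _ (≤-trans a≤b (residuation₂ _ _ _ (≤-refl _)))

  ⊙-monoʳ : ∀ {a b} d → a ≤ b → (d ⊙ a) ≤ (d ⊙ b)
  ⊙-monoʳ {a} {b} d a≤b = ≡-≤-trans (⊙-comm d a) (≤-≡-trans (⊙-monoˡ d a≤b) (⊙-comm b d))

  ⊙-identityˡ : ∀ a → 𝟙 ⊙ a ≡ a
  ⊙-identityˡ a = trans (⊙-comm 𝟙 a) (⊙-identityʳ a)

  ¬-antitone : ∀ {x y} → x ≤ y → (¬ y) ≤ (¬ x)
  ¬-antitone {x} {y} x≤y = residuation₂ _ _ _ (≤-trans (⊙-monoʳ (¬ y) x≤y) (⇒-eval y 𝟘))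

  ¬¬-mono : ∀ {x y} → x ≤ y → (¬ (¬ x)) ≤ (¬ (¬ y))
  ¬¬-mono x≤y = ¬-antitone (¬-antitone x≤y)

  ≤-¬¬ : ∀ x → x ≤ (¬ (¬ x))
  ≤-¬¬ x = residuation₂ _ _ _ (≡-≤-trans (⊙-comm x (¬ x)) (⇒-eval x 𝟘))

  ¬¬¬ : ∀ x → ¬ (¬ (¬ x)) ≡ ¬ x
  ¬¬¬ x = ≤-antisym (¬-antitone (≤-¬¬ x)) (≤-¬¬ (¬ x))

  Reg-¬¬ : ∀ x → Reg (¬ (¬ x))
  Reg-¬¬ x = cong ¬_ (¬¬¬ x)

  ¬𝟘 : ¬ 𝟘 ≡ 𝟙
  ¬𝟘 = ≤-antisym (𝟙-greatest _) (residuation₂ _ _ _ (≡-≤-trans (⊙-identityˡ 𝟘) (≤-refl 𝟘)))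

  ¬𝟙 : ¬ 𝟙 ≡ 𝟘
  ¬𝟙 = ≤-antisym (≡-≤-trans (sym (⊙-identityʳ (¬ 𝟙))) (⇒-eval 𝟙 𝟘)) (𝟘-least _)

  Reg-𝟘 : Reg 𝟘
  Reg-𝟘 = trans (cong ¬_ ¬𝟘) ¬𝟙

  Reg-𝟙 : Reg 𝟙
  Reg-𝟙 = trans (cong ¬_ ¬𝟙) ¬𝟘

  -- If a annihilates b then it annihilates ¬¬b: a ⊙ b ≤ 𝟘 gives a ≤ ¬b.
  annihilate-¬¬ : ∀ {a b} → (a ⊙ b) ≤ 𝟘 → (a ⊙ ¬ (¬ b)) ≤ 𝟘
  annihilate-¬¬ {a} {b} ab≤𝟘 =
    ≤-trans (⊙-monoˡ (¬ (¬ b)) (residuation₂ _ _ _ ab≤𝟘))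
            (≡-≤-trans (⊙-comm (¬ b) (¬ (¬ b))) (⇒-eval (¬ b) 𝟘))

  ⊙-swapʳ : ∀ a b d → (a ⊙ b) ⊙ d ≡ (a ⊙ d) ⊙ b
  ⊙-swapʳ a b d = begin
    (a ⊙ b) ⊙ d  ≡⟨ ⊙-assoc a b d ⟩
    a ⊙ (b ⊙ d)  ≡⟨ cong (a ⊙_) (⊙-comm b d) ⟩
    a ⊙ (d ⊙ b)  ≡⟨ sym (⊙-assoc a d b) ⟩
    (a ⊙ d) ⊙ b  ∎

  -- With p = ¬(x ⊙ y), the product p ⊙ x ⊙ y is below 𝟘,
  -- and annihilate-¬¬ replaces first y, then x by its double negation.
  ¬¬-⊙ : ∀ x y → (¬ (¬ x) ⊙ ¬ (¬ y)) ≤ (¬ (¬ (x ⊙ y)))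
  ¬¬-⊙ x y = residuation₂ _ _ _ (≡-≤-trans regroup (annihilate-¬¬ p¬¬y-x≤𝟘))
    where
    p = ¬ (x ⊙ y)
    px-y≤𝟘 : ((p ⊙ x) ⊙ y) ≤ 𝟘
    px-y≤𝟘 = ≡-≤-trans (⊙-assoc p x y) (⇒-eval (x ⊙ y) 𝟘)
    p¬¬y-x≤𝟘 : ((p ⊙ ¬ (¬ y)) ⊙ x) ≤ 𝟘
    p¬¬y-x≤𝟘 = ≡-≤-trans (⊙-swapʳ p (¬ (¬ y)) x) (annihilate-¬¬ px-y≤𝟘)
    regroup : (¬ (¬ x) ⊙ ¬ (¬ y)) ⊙ p ≡ (p ⊙ ¬ (¬ y)) ⊙ ¬ (¬ x)
    regroup = begin
      (¬ (¬ x) ⊙ ¬ (¬ y)) ⊙ p  ≡⟨ ⊙-assoc _ _ p ⟩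
      ¬ (¬ x) ⊙ (¬ (¬ y) ⊙ p)  ≡⟨ cong (¬ (¬ x) ⊙_) (⊙-comm _ p) ⟩
      ¬ (¬ x) ⊙ (p ⊙ ¬ (¬ y))  ≡⟨ ⊙-comm _ _ ⟩
      (p ⊙ ¬ (¬ y)) ⊙ ¬ (¬ x)  ∎

  ≤⇒∧* : ∀ {u v} → Reg u → u ≤ v → (u ∧* v) ≡ u
  ≤⇒∧* {u} {v} reg-u u≤v = trans (cong (λ t → ¬ (¬ t)) u≤v) reg-u

  ∧*⇒≤ : ∀ {u v} → Reg v → (u ∧* v) ≡ u → u ≤ v
  ∧*⇒≤ {u} {v} reg-v u∧*v≡u =
    ≡-≤-trans (sym u∧*v≡u) (≤-≡-trans (¬¬-mono (∧-lowerʳ u v)) reg-v)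

module FilterCorrespondence {c : Level} (A : ResLat c) where
  open ResLat A
  open Calculus A

  module FA = FilterTheory {c} (λ _ → ⊤) _⊙_ _∧_
  module FR = FilterTheory Reg _⊙*_ _∧*_

  _↑ : FR.Subset → FA.Subset
  (N ↑) x = N (¬ (¬ x))

  _↓ : FA.Subset → FR.Subset
  (G ↓) x = G x × Reg x

  filter-¬¬ : ∀ G → FA.IsFilter G → ∀ x → G x → G (¬ (¬ x))
  filter-¬¬ G (_ , _ , _ , G-up) x Gx = G-up x _ Gx tt (≤-¬¬ x)

  ↑-regular : ∀ N {x} → Reg x → (N ↑) x → N x
  ↑-regular N reg-x = subst N reg-x

  regular-↑ : ∀ N {x} → Reg x → N x → (N ↑) x
  regular-↑ N reg-x = subst N (sym reg-x)

  ↑-filter : ∀ N → FR.IsFilter N → FA.IsFilter (N ↑)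
  ↑-filter N (N⊆Reg , (b , Nb) , N-⊙ , N-up) = (λ _ _ → tt) , (𝟙 , N𝟙↑) , ↑-⊙ , ↑-up
    where
    N𝟙↑ : (N ↑) 𝟙
    N𝟙↑ = regular-↑ N Reg-𝟙 (N-up b 𝟙 Nb Reg-𝟙 (≤⇒∧* (N⊆Reg b Nb) (𝟙-greatest b)))
    ↑-⊙ : ∀ x y → (N ↑) x → (N ↑) y → (N ↑) (x ⊙ y)
    ↑-⊙ x y Nx Ny = N-up _ _ (N-⊙ _ _ Nx Ny) (Reg-¬¬ (x ⊙ y))
      (≤⇒∧* (Reg-¬¬ _) (≤-≡-trans (¬¬-mono (¬¬-⊙ x y)) (Reg-¬¬ (x ⊙ y))))
    ↑-up : ∀ x y → (N ↑) x → ⊤ → (x ∧ y) ≡ x → (N ↑) y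
    ↑-up x y Nx _ x≤y = N-up _ _ Nx (Reg-¬¬ y) (≤⇒∧* (Reg-¬¬ x) (¬¬-mono x≤y))

  ↑-proper : ∀ N → FR.IsProper N → FA.IsProper (N ↑)
  ↑-proper N (b , reg-b , ¬Nb) = b , tt , λ Nb↑ → ¬Nb (↑-regular N reg-b Nb↑)

  ↓-filter : ∀ G → FA.IsFilter G → FR.IsFilter (G ↓)
  ↓-filter G fG@(_ , (b , Gb) , G-⊙ , G-up) =
    (λ _ → proj₂) , (𝟙 , G-up b 𝟙 Gb tt (𝟙-greatest b) , Reg-𝟙) , ↓-⊙ , ↓-up
    where
    ↓-⊙ : ∀ x y → (G ↓) x → (G ↓) y → (G ↓) (x ⊙* y)
    ↓-⊙ x y (Gx , _) (Gy , _) = filter-¬¬ G fG (x ⊙ y) (G-⊙ x y Gx Gy) , Reg-¬¬ (x ⊙ y)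
    ↓-up : ∀ x y → (G ↓) x → Reg y → (x ∧* y) ≡ x → (G ↓) y
    ↓-up x y (Gx , _) reg-y x∧*y≡x = G-up x y Gx tt (∧*⇒≤ reg-y x∧*y≡x) , reg-y

  -- A proper filter of A misses 𝟘, which is regular.
  ↓-proper : ∀ G → FA.IsFilter G → FA.IsProper G → FR.IsProper (G ↓)
  ↓-proper G (_ , _ , _ , G-up) (b , _ , ¬Gb) =
    𝟘 , Reg-𝟘 , λ G𝟘↓ → ¬Gb (G-up 𝟘 b (proj₁ G𝟘↓) tt (𝟘-least b))

  -- A filter G of A above N↑ gives the filter G↓ of Reg(A) above N,
  -- so maximality of N forces G ⊆ N↑.
  ↑-maximal : ∀ N → FR.IsMaximalFilter N → FA.IsMaximalFilter (N ↑)
  ↑-maximal N (fN , pN , N-max) = ↑-filter N fN , ↑-proper N pN , maximal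
    where
    maximal : ∀ G → FA.IsFilter G → FA.IsProper G → (N ↑) FA.⊆ G → G FA.⊆ (N ↑)
    maximal G fG pG N↑⊆G x Gx =
      N-max (G ↓) (↓-filter G fG) (↓-proper G fG pG) N⊆G↓ _ (filter-¬¬ G fG x Gx , Reg-¬¬ x)
      where
      N⊆G↓ : N FR.⊆ (G ↓)
      N⊆G↓ y Ny = N↑⊆G y (regular-↑ N (proj₁ fN y Ny) Ny) , proj₁ fN y Ny

  -- A filter G of Reg(A) above M↓ gives the filter G↑ of A above M,
  -- so maximality of M forces G ⊆ M↓.
  ↓-maximal : ∀ M → FA.IsMaximalFilter M → FR.IsMaximalFilter (M ↓)
  ↓-maximal M (fM , pM , M-max) = ↓-filter M fM , ↓-proper M fM pM , maximal
    where
    maximal : ∀ G → FR.IsFilter G → FR.IsProper G → (M ↓) FR.⊆ G → G FR.⊆ (M ↓)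
    maximal G fG pG M↓⊆G x Gx =
      M-max (G ↑) (↑-filter G fG) (↑-proper G pG) M⊆G↑ x (regular-↑ G reg-x Gx) , reg-x
      where
      reg-x = proj₁ fG x Gx
      M⊆G↑ : M FA.⊆ (G ↑)
      M⊆G↑ y My = M↓⊆G _ (filter-¬¬ M fM y My , Reg-¬¬ y)

proposition3p5 : {c : Level} (A : ResLat c) → ResLat.IsGlivenko A →
    ∀ a → RadReg A a ⇔ (RadA A a × ResLat.Reg A a)
proposition3p5 A _ a = mk⇔ RadReg⇒ ⇒RadReg
  where
  open FilterCorrespondence A
  -- every maximal M of A contains M↓, a maximal filter of Reg(A)
  RadReg⇒ : RadReg A a → RadA A a × ResLat.Reg A a
  RadReg⇒ (reg-a , in-all) = (tt , λ M M-max → proj₁ (in-all (M ↓) (↓-maximal M M-max))) , reg-a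
  -- every maximal N of Reg(A) is the trace of the maximal filter N↑ of A
  ⇒RadReg : RadA A a × ResLat.Reg A a → RadReg A a
  ⇒RadReg ((_ , in-all) , reg-a) =
    reg-a , λ N N-max → ↑-regular N reg-a (in-all (N ↑) (↑-maximal N N-max))
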